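{- Let $S$ be a single-homomorphism system of equations in standard form (as defined in the context). If the path labeled dependency graph $\mathcal{LD}$ of $S$ contains a directed cycle, then $S$ has no unifier modulo one-sided distributivity.
   Context: One-sided distributivity is the equational theory over the binary symbols $+,\times$ generated by $X \times (Y+Z) = X\times Y + X \times Z$; unification is elementary (terms built only from $+$, $\times$ and variables). Typed setting: two types $\tau_1,\tau_2$ with $\times:\tau_1*\tau_2\to\tau_2$ and $+:\tau_2*\tau_2\to\tau_2$. A single-homomorphism system is a finite set of equations in standard form in which exactly one variable $T$ has type $\tau_1$; every equation has one of the forms $X =^? Y$ ($Y$ a variable distinct from $X$), $X =^? Y + Z$, or $X =^? T \times Y$, with $X,Y,Z$ variables of type $\tau_2$; the equation $X =^? T\times Y$ is also written $X =^? h(Y)$. The graph $\mathcal{LD}$ of $S$ has as nodes the $\tau_2$-variables of $S$; for each equation $X =^? h(Y)$ a lateral edge from $X$ to $Y$ (labeled $h^1$), and for each equation $X =^? X_1 + X_2$ downward edges from $X$ to $X_1$ and from $X$ to $X_2$. -}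

module Defs where

open import Data.Nat using (ℕ)
open import Data.List using (List)
open import Data.List.Membership.Propositional using (_∈_)
open import Data.List.Relation.Unary.All using (All)
open import Data.Product using (∃; _×_; _,_)
open import Data.Unit using (⊤)
open import Relation.Nullary using (¬_)
open import Relation.Binary.PropositionalEquality using (_≡_)
open import Relation.Binary.Construct.Closure.Transitive using (TransClosure)

-- Typed signature: two types τ₁, τ₂;  × : τ₁ * τ₂ → τ₂,  + : τ₂ * τ₂ → τ₂.
-- Variables of each type are indexed by ℕ (countably many of each type).
V₁ : Set
V₁ = ℕ

V₂ : Set
V₂ = ℕ

-- Terms of type τ₁: no function symbol has result type τ₁, so these are
-- exactly the τ₁-variables.
Term₁ : Set
Term₁ = V₁

data Term₂ : Set where
  var  : V₂ → Term₂
  _⊕_  : Term₂ → Term₂ → Term₂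
  _⊗_  : Term₁ → Term₂ → Term₂

infixl 6 _⊕_
infixr 7 _⊗_

data _≈_ : Term₂ → Term₂ → Set where
  ≈-refl  : ∀ {s} → s ≈ s
  ≈-sym   : ∀ {s t} → s ≈ t → t ≈ s
  ≈-trans : ∀ {s t u} → s ≈ t → t ≈ u → s ≈ u
  ≈-⊕     : ∀ {s s' t t'} → s ≈ s' → t ≈ t' → (s ⊕ t) ≈ (s' ⊕ t')
  ≈-⊗     : ∀ {x s s'} → s ≈ s' → (x ⊗ s) ≈ (x ⊗ s')
  ≈-dist  : ∀ x s t → (x ⊗ (s ⊕ t)) ≈ ((x ⊗ s) ⊕ (x ⊗ t))

infix 4 _≈_

-- Equations of a single-homomorphism system in standard form.  The unique
-- τ₁-variable T is a parameter of the system (see SHSystem below).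
data Equation : Set where
  eqVar  : V₂ → V₂ → Equation
  eqPlus : V₂ → V₂ → V₂ → Equation
  eqHom  : V₂ → V₂ → Equation          -- X =? T × Y   (i.e. X =? h(Y))

WellFormed : Equation → Set
WellFormed (eqVar X Y)    = ¬ (X ≡ Y)
WellFormed (eqPlus _ _ _) = ⊤
WellFormed (eqHom _ _)    = ⊤

record SHSystem : Set where
  constructor shs
  field
    T    : V₁
    eqns : List Equation
    wf   : All WellFormed eqns

open SHSystem public

record Subst : Set where
  constructor subst
  field
    σ₁ : V₁ → Term₁
    σ₂ : V₂ → Term₂

open Subst public

_·_ : Subst → Term₂ → Term₂
σ · var X   = σ₂ σ X
σ · (s ⊕ t) = (σ · s) ⊕ (σ · t)
σ · (x ⊗ s) = σ₁ σ x ⊗ (σ · s)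

SolvesEq : V₁ → Subst → Equation → Set
SolvesEq T σ (eqVar X Y)    = σ · var X ≈ σ · var Y
SolvesEq T σ (eqPlus X Y Z) = σ · var X ≈ σ · (var Y ⊕ var Z)
SolvesEq T σ (eqHom X Y)    = σ · var X ≈ σ · (T ⊗ var Y)

IsUnifier : SHSystem → Subst → Set
IsUnifier S σ = All (SolvesEq (T S) σ) (eqns S)

data Edge (S : SHSystem) : V₂ → V₂ → Set where
  lateral : ∀ {X Y} → eqHom X Y ∈ eqns S → Edge S X Y
  downL   : ∀ {X Y Z} → eqPlus X Y Z ∈ eqns S → Edge S X Y
  downR   : ∀ {X Y Z} → eqPlus X Y Z ∈ eqns S → Edge S X Z

HasCycle : SHSystem → Set
HasCycle S = ∃ λ X → TransClosure (Edge S) X X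

module Submission where

-- Proof idea: the number of leaves and the ⊗-nesting depth of a term are both
-- invariant under distributivity, and their sum strictly decreases from a
-- term to each of its immediate subterms.  A unifier would therefore make
-- this measure strictly decrease along every edge of LD, which is impossible
-- around a cycle.

open import Defs
open import Relation.Nullary using (¬_)
open import Data.Product using (∃; _,_)
open import Data.Nat using (ℕ; suc; _+_; _⊔_; _<_; _≤_; s≤s; z≤n)
open import Data.Nat.Properties
open import Data.List.Relation.Unary.All using (lookup)
open import Relation.Binary.Core using (Rel)
open import Relation.Binary.PropositionalEquality using (_≡_; refl; sym; trans; cong; cong₂)
open import Relation.Binary.Construct.Closure.Transitive using (TransClosure; [_]; _∷_)

leaves : Term₂ → ℕ
leaves (var _) = 1
leaves (s ⊕ t) = leaves s + leaves t
leaves (x ⊗ s) = leaves s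

⊗-depth : Term₂ → ℕ
⊗-depth (var _) = 0
⊗-depth (s ⊕ t) = ⊗-depth s ⊔ ⊗-depth t
⊗-depth (x ⊗ s) = suc (⊗-depth s)

weight : Term₂ → ℕ
weight s = leaves s + ⊗-depth s

leaves-cong : ∀ {s t} → s ≈ t → leaves s ≡ leaves t
leaves-cong ≈-refl         = refl
leaves-cong (≈-sym p)      = sym (leaves-cong p)
leaves-cong (≈-trans p q)  = trans (leaves-cong p) (leaves-cong q)
leaves-cong (≈-⊕ p q)      = cong₂ _+_ (leaves-cong p) (leaves-cong q)
leaves-cong (≈-⊗ p)        = leaves-cong p
leaves-cong (≈-dist x s t) = refl

⊗-depth-cong : ∀ {s t} → s ≈ t → ⊗-depth s ≡ ⊗-depth t
⊗-depth-cong ≈-refl         = refl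
⊗-depth-cong (≈-sym p)      = sym (⊗-depth-cong p)
⊗-depth-cong (≈-trans p q)  = trans (⊗-depth-cong p) (⊗-depth-cong q)
⊗-depth-cong (≈-⊕ p q)      = cong₂ _⊔_ (⊗-depth-cong p) (⊗-depth-cong q)
⊗-depth-cong (≈-⊗ p)        = cong suc (⊗-depth-cong p)
⊗-depth-cong (≈-dist x s t) = refl

weight-cong : ∀ {s t} → s ≈ t → weight s ≡ weight t
weight-cong p = cong₂ _+_ (leaves-cong p) (⊗-depth-cong p)

leaves-positive : ∀ s → 1 ≤ leaves s
leaves-positive (var _) = s≤s z≤n
leaves-positive (s ⊕ t) = ≤-trans (leaves-positive s) (m≤m+n (leaves s) (leaves t))
leaves-positive (x ⊗ s) = leaves-positive s

weight-⊕ˡ : ∀ s t → weight s < weight (s ⊕ t)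
weight-⊕ˡ s t = +-mono-<-≤ (m<m+n (leaves s) (leaves-positive t)) (m≤m⊔n (⊗-depth s) (⊗-depth t))

weight-⊕ʳ : ∀ s t → weight t < weight (s ⊕ t)
weight-⊕ʳ s t = +-mono-<-≤ (m<n+m (leaves t) (leaves-positive s)) (m≤n⊔m (⊗-depth s) (⊗-depth t))

weight-⊗ : ∀ x s → weight s < weight (x ⊗ s)
weight-⊗ x s rewrite +-suc (leaves s) (⊗-depth s) = n<1+n (weight s)

decreasing⇒acyclic : ∀ {a ℓ} {A : Set a} {_⇝_ : Rel A ℓ} (f : A → ℕ) →
                     (∀ {x y} → x ⇝ y → f y < f x) →
                     ∀ {x} → ¬ TransClosure _⇝_ x x
decreasing⇒acyclic {_⇝_ = _⇝_} f decreasing p = <-irrefl refl (path-decreasing p)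
  where
  path-decreasing : ∀ {x y} → TransClosure _⇝_ x y → f y < f x
  path-decreasing [ e ]   = decreasing e
  path-decreasing (e ∷ p) = <-trans (path-decreasing p) (decreasing e)

unifier-weight-decreasing : ∀ S σ → IsUnifier S σ →
                            ∀ {X Y} → Edge S X Y → weight (σ₂ σ Y) < weight (σ₂ σ X)
unifier-weight-decreasing S σ u (lateral {Y = Y} X=hY) =
  <-≤-trans (weight-⊗ (σ₁ σ (T S)) (σ₂ σ Y)) (≤-reflexive (sym (weight-cong (lookup u X=hY))))
unifier-weight-decreasing S σ u (downL {Y = Y} {Z} X=Y+Z) =
  <-≤-trans (weight-⊕ˡ (σ₂ σ Y) (σ₂ σ Z)) (≤-reflexive (sym (weight-cong (lookup u X=Y+Z))))
unifier-weight-decreasing S σ u (downR {Y = Y} {Z} X=Y+Z) =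
  <-≤-trans (weight-⊕ʳ (σ₂ σ Y) (σ₂ σ Z)) (≤-reflexive (sym (weight-cong (lookup u X=Y+Z))))

lemma5p6 : (S : SHSystem) → HasCycle S → ¬ (∃ λ σ → IsUnifier S σ)
lemma5p6 S (_ , cycle) (σ , unifier) =
  decreasing⇒acyclic (λ X → weight (σ₂ σ X)) (unifier-weight-decreasing S σ unifier) cycle
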